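{- Let $(\Sigma,\mathscr R)$ be a Dedukti theory with $\hookrightarrow_{\beta\mathscr R}$ confluent and $\mathscr R$ arity-preserving, and let $M$ be an object or a type family. (1) If $N$ is an object, then $M\{N/x\}$ is an object or a type family and $|M\{N/x\}|=|M|\{|N|/x\}$. (2) If $M\hookrightarrow_\beta N$, then $N$ is an object or a type family and $|M|\hookrightarrow_\beta^+|N|$.
   Context: Dedukti terms $x\mid c[\vec M]\mid\mathtt{TYPE}\mid\mathtt{KIND}\mid MN\mid\lambda x:A.M\mid\Pi x:A.B$ with constants of fixed arity, declared in a signature $\Sigma$ as $c[\Delta]:A$; a constant is type-level (written $\alpha$) if its declared type is of the form $\Pi\vec x:\vec B.\mathtt{TYPE}$, otherwise object-level (written $a$); a rule is type-level if its head constant is. $\mathscr R$ is arity-preserving if every type-level rule has right-hand side in $R::=\alpha[\vec M]\mid R\,N\mid\lambda x:A.R$. Type families and objects: $T::=\alpha[\vec O]\mid T\,O\mid\lambda x:T.T\mid\Pi x:T.T$; $O::=x\mid a[\vec O]\mid O\,O\mid\lambda x:T.O$. Simple types $\sigma::=*\mid\sigma\to\sigma$ with constants $\pi_\sigma:*\to(\sigma\to*)\to*$. Partial maps: $\|\mathtt{TYPE}\|=*$, $\|\alpha[\vec M]\|=*$, $\|\Pi x:A.B\|=\|A\|\to\|B\|$, $\|A\,N\|=\|A\|$, $\|\lambda x:A.B\|=\|B\|$; $|x|=x$, $|c[M_1,\dots,M_n]|=c\,|M_1|\cdots|M_n|$, $|MN|=|M|\,|N|$, $|\lambda x:A.M|=(\lambda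 z.\lambda x.|M|)\,|A|$ with $z$ fresh, $|\Pi x:A.B|=\pi_{\|A\|}\,|A|\,(\lambda x.|B|)$. $\hookrightarrow_\beta^+$ denotes one or more $\beta$-steps in the untyped $\lambda$-calculus with constants. -}

module Defs where

open import Data.Nat using (ℕ; zero; suc; _<ᵇ_; _≡ᵇ_; pred)
open import Data.Bool using (Bool; true; false; if_then_else_; T; not)
open import Data.Fin using (Fin)
open import Data.Vec using (Vec; []; _∷_; lookup; _[_]≔_)
open import Data.List using (List; []; _∷_)
open import Data.Maybe using (Maybe; just; nothing; _>>=_)
open import Data.Product using (Σ; _×_; _,_; ∃)
open import Data.Sum using (_⊎_)
open import Relation.Binary.PropositionalEquality using (_≡_)
open import Relation.Binary.Construct.Closure.ReflexiveTransitive using (Star)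
open import Relation.Binary.Construct.Closure.Transitive using (TransClosure)

record Consts : Set₁ where
  field
    Const : Set
    arity : Const → ℕ
open Consts public

-- Dedukti terms (de Bruijn indices):
--   x | c[M₁,…,Mₙ] | TYPE | KIND | M N | λ x:A. M | Π x:A. B
data Term (K : Consts) : Set where
  var  : ℕ → Term K
  con  : (c : Const K) → Vec (Term K) (arity K c) → Term K
  TYPE : Term K
  KIND : Term K
  app  : Term K → Term K → Term K
  lam  : Term K → Term K → Term K      -- lam A M  =  λ x:A. M  (x bound in M)
  pi   : Term K → Term K → Term K      -- pi A B   =  Π x:A. B  (x bound in B)

data SType : Set where
  ⋆   : SType
  _⇒_ : SType → SType → SType

data UTerm (K : Consts) : Set where
  var : ℕ → UTerm K
  con : Const K → UTerm K
  πc  : SType → UTerm K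
  app : UTerm K → UTerm K → UTerm K
  lam : UTerm K → UTerm K

ext : (ℕ → ℕ) → ℕ → ℕ
ext ρ zero    = zero
ext ρ (suc i) = suc (ρ i)

module _ {K : Consts} where
  mutual
    rename : (ℕ → ℕ) → Term K → Term K
    rename ρ (var i)   = var (ρ i)
    rename ρ (con c xs) = con c (renames ρ xs)
    rename ρ TYPE      = TYPE
    rename ρ KIND      = KIND
    rename ρ (app M N) = app (rename ρ M) (rename ρ N)
    rename ρ (lam A M) = lam (rename ρ A) (rename (ext ρ) M)
    rename ρ (pi A B)  = pi (rename ρ A) (rename (ext ρ) B)

    renames : ∀ {n} → (ℕ → ℕ) → Vec (Term K) n → Vec (Term K) n
    renames ρ []       = []
    renames ρ (x ∷ xs) = rename ρ x ∷ renames ρ xs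

  exts : (ℕ → Term K) → ℕ → Term K
  exts σ zero    = var zero
  exts σ (suc i) = rename suc (σ i)

  mutual
    sub : (ℕ → Term K) → Term K → Term K
    sub σ (var i)    = σ i
    sub σ (con c xs) = con c (subs σ xs)
    sub σ TYPE       = TYPE
    sub σ KIND       = KIND
    sub σ (app M N)  = app (sub σ M) (sub σ N)
    sub σ (lam A M)  = lam (sub σ A) (sub (exts σ) M)
    sub σ (pi A B)   = pi (sub σ A) (sub (exts σ) B)

    subs : ∀ {n} → (ℕ → Term K) → Vec (Term K) n → Vec (Term K) n
    subs σ []       = []
    subs σ (x ∷ xs) = sub σ x ∷ subs σ xs

  -- M { N / x } : replace variable x by N; variables above x are
  -- decremented (x is removed from the context).
  σAt : ℕ → Term K → ℕ → Term K
  σAt x N i = if i <ᵇ x then var i else (if i ≡ᵇ x then N else var (pred i))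

  _[_≔_] : Term K → ℕ → Term K → Term K
  M [ x ≔ N ] = sub (σAt x N) M

  urename : (ℕ → ℕ) → UTerm K → UTerm K
  urename ρ (var i)   = var (ρ i)
  urename ρ (con c)   = con c
  urename ρ (πc s)    = πc s
  urename ρ (app M N) = app (urename ρ M) (urename ρ N)
  urename ρ (lam M)   = lam (urename (ext ρ) M)

  uexts : (ℕ → UTerm K) → ℕ → UTerm K
  uexts σ zero    = var zero
  uexts σ (suc i) = urename suc (σ i)

  usub : (ℕ → UTerm K) → UTerm K → UTerm K
  usub σ (var i)   = σ i
  usub σ (con c)   = con c
  usub σ (πc s)    = πc s
  usub σ (app M N) = app (usub σ M) (usub σ N)
  usub σ (lam M)   = lam (usub (uexts σ) M)

  uσAt : ℕ → UTerm K → ℕ → UTerm K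
  uσAt x N i = if i <ᵇ x then var i else (if i ≡ᵇ x then N else var (pred i))

  _[_≔_]ᵘ : UTerm K → ℕ → UTerm K → UTerm K
  M [ x ≔ N ]ᵘ = usub (uσAt x N) M

  appsT : Term K → List (Term K) → Term K
  appsT h []       = h
  appsT h (N ∷ Ns) = appsT (app h N) Ns

  appsU : ∀ {n} → UTerm K → Vec (UTerm K) n → UTerm K
  appsU h []       = h
  appsU h (u ∷ us) = appsU (app h u) us

module _ {K : Consts} where
  data Closure (H : Term K → Term K → Set) : Term K → Term K → Set where
    head : ∀ {M N} → H M N → Closure H M N
    appl : ∀ {M M′ N} → Closure H M M′ → Closure H (app M N) (app M′ N)
    appr : ∀ {M N N′} → Closure H N N′ → Closure H (app M N) (app M N′)
    laml : ∀ {A A′ M} → Closure H A A′ → Closure H (lam A M) (lam A′ M)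
    lamr : ∀ {A M M′} → Closure H M M′ → Closure H (lam A M) (lam A M′)
    pil  : ∀ {A A′ B} → Closure H A A′ → Closure H (pi A B) (pi A′ B)
    pir  : ∀ {A B B′} → Closure H B B′ → Closure H (pi A B) (pi A B′)
    arg  : ∀ {c xs N} (i : Fin (arity K c)) → Closure H (lookup xs i) N →
           Closure H (con c xs) (con c (xs [ i ]≔ N))

  data βHead : Term K → Term K → Set where
    β : ∀ {A M N} → βHead (app (lam A M) N) (M [ 0 ≔ N ])

  _↪β_ : Term K → Term K → Set
  _↪β_ = Closure βHead

  data _↪βᵘ_ : UTerm K → UTerm K → Set where
    β    : ∀ {M N} → app (lam M) N ↪βᵘ (M [ 0 ≔ N ]ᵘ)
    appl : ∀ {M M′ N} → M ↪βᵘ M′ → app M N ↪βᵘ app M′ N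
    appr : ∀ {M N N′} → N ↪βᵘ N′ → app M N ↪βᵘ app M N′
    lamc : ∀ {M M′} → M ↪βᵘ M′ → lam M ↪βᵘ lam M′

  _↪βᵘ⁺_ : UTerm K → UTerm K → Set
  _↪βᵘ⁺_ = TransClosure _↪βᵘ_

record Rule (K : Consts) : Set where
  field
    hd    : Const K
    largs : Vec (Term K) (arity K hd)
    lapps : List (Term K)
    rhs   : Term K
  lhs : Term K
  lhs = appsT (con hd largs) lapps
open Rule public

record Theory (K : Consts) : Set₁ where
  field
    ctx   : (c : Const K) → Vec (Term K) (arity K c)  -- Δ in c[Δ] : A
    decl  : (c : Const K) → Term K                     -- A in c[Δ] : A
    RuleIx : Set
    rule  : RuleIx → Rule K
open Theory public

-- A type is of the form Π x⃗:B⃗. TYPE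
endsInTYPE : ∀ {K} → Term K → Bool
endsInTYPE TYPE     = true
endsInTYPE (pi A B) = endsInTYPE B
endsInTYPE _        = false

module _ {K : Consts} (Th : Theory K) where
  typeLevel : Const K → Bool
  typeLevel c = endsInTYPE (decl Th c)

  data ℛHead : Term K → Term K → Set where
    rw : (ρ : RuleIx Th) (σ : ℕ → Term K) →
         ℛHead (sub σ (lhs (rule Th ρ))) (sub σ (rhs (rule Th ρ)))

  data βℛHead (M N : Term K) : Set where
    βstep : βHead M N → βℛHead M N
    ℛstep : ℛHead M N → βℛHead M N

  _↪βℛ_ : Term K → Term K → Set
  _↪βℛ_ = Closure βℛHead

  Confluent : Set
  Confluent = ∀ {M N₁ N₂} → Star _↪βℛ_ M N₁ → Star _↪βℛ_ M N₂ →
              ∃ λ P → Star _↪βℛ_ N₁ P × Star _↪βℛ_ N₂ P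

  data RForm : Term K → Set where
    rcon : ∀ {c xs} → T (typeLevel c) → RForm (con c xs)
    rapp : ∀ {R N} → RForm R → RForm (app R N)
    rlam : ∀ {A R} → RForm R → RForm (lam A R)

  ArityPreserving : Set
  ArityPreserving = (ρ : RuleIx Th) → T (typeLevel (hd (rule Th ρ))) →
                    RForm (rhs (rule Th ρ))

  mutual
    data Fam : Term K → Set where
      fcon : ∀ {c xs} → T (typeLevel c) → Objs xs → Fam (con c xs)
      fapp : ∀ {A O} → Fam A → Obj O → Fam (app A O)
      flam : ∀ {A B} → Fam A → Fam B → Fam (lam A B)
      fpi  : ∀ {A B} → Fam A → Fam B → Fam (pi A B)

    data Obj : Term K → Set where
      ovar : ∀ {i} → Obj (var i)
      ocon : ∀ {c xs} → T (not (typeLevel c)) → Objs xs → Obj (con c xs)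
      oapp : ∀ {M N} → Obj M → Obj N → Obj (app M N)
      olam : ∀ {A M} → Fam A → Obj M → Obj (lam A M)

    data Objs : ∀ {n} → Vec (Term K) n → Set where
      []  : Objs []
      _∷_ : ∀ {n M} {Ms : Vec (Term K) n} → Obj M → Objs Ms → Objs (M ∷ Ms)

  ObjOrFam : Term K → Set
  ObjOrFam M = Obj M ⊎ Fam M

  ‖_‖ : Term K → Maybe SType
  ‖ TYPE ‖     = just ⋆
  ‖ con c xs ‖ = if typeLevel c then just ⋆ else nothing
  ‖ pi A B ‖   = ‖ A ‖ >>= λ a → ‖ B ‖ >>= λ b → just (a ⇒ b)
  ‖ app A N ‖  = ‖ A ‖
  ‖ lam A B ‖  = ‖ B ‖
  ‖ var _ ‖    = nothing
  ‖ KIND ‖     = nothing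

  mutual
    ∣_∣ : Term K → Maybe (UTerm K)
    ∣ var i ∣    = just (var i)
    ∣ con c xs ∣ = ∣ xs ∣* >>= λ us → just (appsU (con c) us)
    ∣ TYPE ∣     = nothing
    ∣ KIND ∣     = nothing
    ∣ app M N ∣  = ∣ M ∣ >>= λ m → ∣ N ∣ >>= λ n → just (app m n)
    -- |λx:A.M| = (λz.λx.|M|) |A| , z fresh
    ∣ lam A M ∣  = ∣ A ∣ >>= λ a → ∣ M ∣ >>= λ m →
                   just (app (lam (lam (urename (ext suc) m))) a)
    ∣ pi A B ∣   = ‖ A ‖ >>= λ s → ∣ A ∣ >>= λ a → ∣ B ∣ >>= λ b →
                   just (app (app (πc s) a) (lam b))

    ∣_∣* : ∀ {n} → Vec (Term K) n → Maybe (Vec (UTerm K) n)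
    ∣ [] ∣*     = just []
    ∣ M ∷ Ms ∣* = ∣ M ∣ >>= λ u → ∣ Ms ∣* >>= λ us → just (u ∷ us)

-- Objects have no simple type (‖O‖ is undefined), so substituting objects leaves ‖·‖
-- unchanged, and then |·| commutes with such substitutions by a routine induction; the
-- same induction shows that objects and type families are closed under them. For (2),
-- a β-redex (λx:A.M) N is translated to (λz.λx.|M|) |A| |N|, which reaches
-- |M|{|N|/x} in two untyped β-steps; every other step is simulated by congruence,
-- the Π case using that β-steps in a type family A preserve ‖A‖.
module Submission where

open import Defs
open import Data.Bool using (true; false)
open import Data.Fin using (Fin) renaming (zero to fzero; suc to fsuc)
open import Data.Maybe using (Maybe; just; nothing; _>>=_; map)
open import Data.Nat using (ℕ; zero; suc; _<ᵇ_; _≡ᵇ_)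
open import Data.Product using (∃; _×_; _,_; proj₁; proj₂)
open import Data.Sum using (inj₁; inj₂)
open import Data.Vec using (Vec; []; _∷_; lookup; _[_]≔_)
import Data.Vec as Vec
open import Function using (_∘_; id)
open import Relation.Binary.Core using (_=[_]⇒_)
open import Relation.Binary.Construct.Closure.Transitive using (TransClosure; [_]; _∷_)
open import Relation.Binary.PropositionalEquality
open ≡-Reasoning

TransClosure-map : ∀ {A : Set} {R : A → A → Set} {f : A → A} →
                   R =[ f ]⇒ R → TransClosure R =[ f ]⇒ TransClosure R
TransClosure-map f-mono [ r ]    = [ f-mono r ]
TransClosure-map f-mono (r ∷ rs) = f-mono r ∷ TransClosure-map f-mono rs

ext-cong : ∀ {ρ ρ′} → ρ ≗ ρ′ → ext ρ ≗ ext ρ′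
ext-cong e zero    = refl
ext-cong e (suc i) = cong suc (e i)

ext-∘ : ∀ ρ ρ′ → ext ρ ∘ ext ρ′ ≗ ext (ρ ∘ ρ′)
ext-∘ ρ ρ′ zero    = refl
ext-∘ ρ ρ′ (suc i) = refl

module _ {K : Consts} where

  private variable
    a m m′ n h h′ : UTerm K

  urename-cong : ∀ {ρ ρ′} → ρ ≗ ρ′ → urename {K} ρ ≗ urename ρ′
  urename-cong e (var i)   = cong var (e i)
  urename-cong e (con c)   = refl
  urename-cong e (πc s)    = refl
  urename-cong e (app m n) = cong₂ app (urename-cong e m) (urename-cong e n)
  urename-cong e (lam m)   = cong lam (urename-cong (ext-cong e) m)

  uexts-cong : ∀ {σ σ′ : ℕ → UTerm K} → σ ≗ σ′ → uexts σ ≗ uexts σ′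
  uexts-cong e zero    = refl
  uexts-cong e (suc i) = cong (urename suc) (e i)

  usub-cong : ∀ {σ σ′ : ℕ → UTerm K} → σ ≗ σ′ → usub σ ≗ usub σ′
  usub-cong e (var i)   = e i
  usub-cong e (con c)   = refl
  usub-cong e (πc s)    = refl
  usub-cong e (app m n) = cong₂ app (usub-cong e m) (usub-cong e n)
  usub-cong e (lam m)   = cong lam (usub-cong (uexts-cong e) m)

  urename-∘ : ∀ ρ ρ′ (m : UTerm K) → urename ρ (urename ρ′ m) ≡ urename (ρ ∘ ρ′) m
  urename-∘ ρ ρ′ (var i)   = refl
  urename-∘ ρ ρ′ (con c)   = refl
  urename-∘ ρ ρ′ (πc s)    = refl
  urename-∘ ρ ρ′ (app m n) = cong₂ app (urename-∘ ρ ρ′ m) (urename-∘ ρ ρ′ n)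
  urename-∘ ρ ρ′ (lam m)   =
    cong lam (trans (urename-∘ (ext ρ) (ext ρ′) m) (urename-cong (ext-∘ ρ ρ′) m))

  usub-urename : ∀ (σ : ℕ → UTerm K) ρ m → usub σ (urename ρ m) ≡ usub (σ ∘ ρ) m
  usub-urename σ ρ (var i)   = refl
  usub-urename σ ρ (con c)   = refl
  usub-urename σ ρ (πc s)    = refl
  usub-urename σ ρ (app m n) = cong₂ app (usub-urename σ ρ m) (usub-urename σ ρ n)
  usub-urename σ ρ (lam m)   =
    cong lam (trans (usub-urename (uexts σ) (ext ρ) m) (usub-cong (λ { zero → refl ; (suc i) → refl }) m))

  urename-usub : ∀ ρ (σ : ℕ → UTerm K) m → urename ρ (usub σ m) ≡ usub (urename ρ ∘ σ) m
  urename-usub ρ σ (var i)   = refl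
  urename-usub ρ σ (con c)   = refl
  urename-usub ρ σ (πc s)    = refl
  urename-usub ρ σ (app m n) = cong₂ app (urename-usub ρ σ m) (urename-usub ρ σ n)
  urename-usub ρ σ (lam m)   = cong lam (trans (urename-usub (ext ρ) (uexts σ) m) (usub-cong lift m))
    where
    lift : urename (ext ρ) ∘ uexts σ ≗ uexts (urename ρ ∘ σ)
    lift zero    = refl
    lift (suc i) = trans (urename-∘ (ext ρ) suc (σ i)) (sym (urename-∘ suc ρ (σ i)))

  usub-id : ∀ {σ : ℕ → UTerm K} → σ ≗ var → usub σ ≗ id
  usub-id e (var i)   = e i
  usub-id e (con c)   = refl
  usub-id e (πc s)    = refl
  usub-id e (app m n) = cong₂ app (usub-id e m) (usub-id e n)
  usub-id e (lam m)   = cong lam (usub-id (λ { zero → refl ; (suc i) → cong (urename suc) (e i) }) m)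

  urename-[0≔] : ∀ ρ (m n : UTerm K) →
                 urename ρ (m [ 0 ≔ n ]ᵘ) ≡ urename (ext ρ) m [ 0 ≔ urename ρ n ]ᵘ
  urename-[0≔] ρ m n = begin
    urename ρ (usub (uσAt 0 n) m)                ≡⟨ urename-usub ρ _ m ⟩
    usub (urename ρ ∘ uσAt 0 n) m                ≡⟨ usub-cong (λ { zero → refl ; (suc i) → refl }) m ⟩
    usub (uσAt 0 (urename ρ n) ∘ ext ρ) m        ≡⟨ usub-urename _ (ext ρ) m ⟨
    usub (uσAt 0 (urename ρ n)) (urename (ext ρ) m) ∎

  urename-↪βᵘ : ∀ ρ → _↪βᵘ_ {K} =[ urename ρ ]⇒ _↪βᵘ_
  urename-↪βᵘ ρ (β {m} {n}) =
    subst (app (lam (urename (ext ρ) m)) (urename ρ n) ↪βᵘ_) (sym (urename-[0≔] ρ m n)) β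
  urename-↪βᵘ ρ (appl s) = appl (urename-↪βᵘ ρ s)
  urename-↪βᵘ ρ (appr s) = appr (urename-↪βᵘ ρ s)
  urename-↪βᵘ ρ (lamc s) = lamc (urename-↪βᵘ (ext ρ) s)

  urename-appsU : ∀ ρ {k} h (us : Vec (UTerm K) k) →
                  urename ρ (appsU h us) ≡ appsU (urename ρ h) (Vec.map (urename ρ) us)
  urename-appsU ρ h []       = refl
  urename-appsU ρ h (u ∷ us) = urename-appsU ρ (app h u) us

  usub-appsU : ∀ τ {k} h (us : Vec (UTerm K) k) →
               usub τ (appsU h us) ≡ appsU (usub τ h) (Vec.map (usub τ) us)
  usub-appsU τ h []       = refl
  usub-appsU τ h (u ∷ us) = usub-appsU τ (app h u) us

  appsU-↪βᵘ⁺ : ∀ {k} (us : Vec (UTerm K) k) → h ↪βᵘ⁺ h′ → appsU h us ↪βᵘ⁺ appsU h′ us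
  appsU-↪βᵘ⁺ []       r = r
  appsU-↪βᵘ⁺ (u ∷ us) r = appsU-↪βᵘ⁺ us (TransClosure-map appl r)

  -- The encoding (λz.λx.m) a of a typed abstraction λx:A.M, with z fresh.
  uλ : UTerm K → UTerm K → UTerm K
  uλ a m = app (lam (lam (urename (ext suc) m))) a

  uΠ : SType → UTerm K → UTerm K → UTerm K
  uΠ s a b = app (app (πc s) a) (lam b)

  urename-uλ : ∀ ρ a m → urename ρ (uλ a m) ≡ uλ (urename ρ a) (urename (ext ρ) m)
  urename-uλ ρ a m = cong (λ m′ → app (lam (lam m′)) (urename ρ a)) (begin
    urename (ext (ext ρ)) (urename (ext suc) m) ≡⟨ urename-∘ _ _ m ⟩
    urename (ext (ext ρ) ∘ ext suc) m           ≡⟨ urename-cong (λ { zero → refl ; (suc i) → refl }) m ⟩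
    urename (ext suc ∘ ext ρ) m                 ≡⟨ urename-∘ _ _ m ⟨
    urename (ext suc) (urename (ext ρ) m)       ∎)

  usub-uλ : ∀ τ a m → usub τ (uλ a m) ≡ uλ (usub τ a) (usub (uexts τ) m)
  usub-uλ τ a m = cong (λ m′ → app (lam (lam m′)) (usub τ a)) (begin
    usub (uexts (uexts τ)) (urename (ext suc) m) ≡⟨ usub-urename _ _ m ⟩
    usub (uexts (uexts τ) ∘ ext suc) m           ≡⟨ usub-cong lift m ⟩
    usub (urename (ext suc) ∘ uexts τ) m         ≡⟨ urename-usub _ _ m ⟨
    urename (ext suc) (usub (uexts τ) m)         ∎)
    where
    lift : uexts (uexts τ) ∘ ext suc ≗ urename (ext suc) ∘ uexts τ
    lift zero    = refl
    lift (suc i) = trans (urename-∘ suc suc (τ i)) (sym (urename-∘ (ext suc) suc (τ i)))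

  uλ-↪βᵘ : m ↪βᵘ m′ → uλ a m ↪βᵘ uλ a m′
  uλ-↪βᵘ s = appl (lamc (lamc (urename-↪βᵘ (ext suc) s)))

  -- The first step discards z, the second substitutes for x.
  uλ-β : app (uλ a m) n ↪βᵘ⁺ (m [ 0 ≔ n ]ᵘ)
  uλ-β {a} {m} {n} = appl β ∷ subst (λ m′ → app (lam m′) n ↪βᵘ⁺ (m [ 0 ≔ n ]ᵘ)) (sym discard) [ β ]
    where
    discard : usub (uexts (uσAt 0 a)) (urename (ext suc) m) ≡ m
    discard = trans (usub-urename _ _ m) (usub-id (λ { zero → refl ; (suc i) → refl }) m)

module _ {K : Consts} (Th : Theory K) where

  private
    ⟦_⟧ : Term K → Maybe (UTerm K)
    ⟦_⟧ = ∣_∣ Th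

    ⟦_⟧* : ∀ {k} → Vec (Term K) k → Maybe (Vec (UTerm K) k)
    ⟦_⟧* = ∣_∣* Th

    ⟪_⟫ : Term K → Maybe SType
    ⟪_⟫ = ‖_‖ Th

    variable
      k : ℕ
      s : SType
      M M′ N N′ A A′ B B′ : Term K
      xs xs′ : Vec (Term K) k
      us : Vec (UTerm K) k
      a b m n : UTerm K
      σ : ℕ → Term K
      τ : ℕ → UTerm K

  ⟦app⟧ : ∀ M N → ⟦ M ⟧ ≡ just m → ⟦ N ⟧ ≡ just n → ⟦ app M N ⟧ ≡ just (app m n)
  ⟦app⟧ M N eM eN rewrite eM | eN = refl

  ⟦lam⟧ : ∀ A M → ⟦ A ⟧ ≡ just a → ⟦ M ⟧ ≡ just m → ⟦ lam A M ⟧ ≡ just (uλ a m)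
  ⟦lam⟧ A M eA eM rewrite eA | eM = refl

  ⟦pi⟧ : ∀ A B → ⟪ A ⟫ ≡ just s → ⟦ A ⟧ ≡ just a → ⟦ B ⟧ ≡ just b → ⟦ pi A B ⟧ ≡ just (uΠ s a b)
  ⟦pi⟧ A B sA eA eB rewrite sA | eA | eB = refl

  ⟦con⟧ : ∀ c (xs : Vec (Term K) (arity K c)) {us} →
          ⟦ xs ⟧* ≡ just us → ⟦ con c xs ⟧ ≡ just (appsU (con c) us)
  ⟦con⟧ c xs e rewrite e = refl

  ⟦∷⟧ : ∀ M (xs : Vec (Term K) k) {u} →
        ⟦ M ⟧ ≡ just u → ⟦ xs ⟧* ≡ just us → ⟦ M ∷ xs ⟧* ≡ just (u ∷ us)
  ⟦∷⟧ M xs eM exs rewrite eM | exs = refl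

  mutual
    rename-Obj : ∀ ρ → Obj Th M → Obj Th (rename ρ M)
    rename-Obj ρ ovar         = ovar
    rename-Obj ρ (ocon t os)  = ocon t (rename-Objs ρ os)
    rename-Obj ρ (oapp o o′)  = oapp (rename-Obj ρ o) (rename-Obj ρ o′)
    rename-Obj ρ (olam f o)   = olam (rename-Fam ρ f) (rename-Obj (ext ρ) o)

    rename-Fam : ∀ ρ → Fam Th A → Fam Th (rename ρ A)
    rename-Fam ρ (fcon t os)  = fcon t (rename-Objs ρ os)
    rename-Fam ρ (fapp f o)   = fapp (rename-Fam ρ f) (rename-Obj ρ o)
    rename-Fam ρ (flam f f′)  = flam (rename-Fam ρ f) (rename-Fam (ext ρ) f′)
    rename-Fam ρ (fpi f f′)   = fpi (rename-Fam ρ f) (rename-Fam (ext ρ) f′)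

    rename-Objs : ∀ ρ → Objs Th xs → Objs Th (renames ρ xs)
    rename-Objs ρ []        = []
    rename-Objs ρ (o ∷ os)  = rename-Obj ρ o ∷ rename-Objs ρ os

  exts-Obj : (∀ i → Obj Th (σ i)) → ∀ i → Obj Th (exts σ i)
  exts-Obj σ-obj zero    = ovar
  exts-Obj σ-obj (suc i) = rename-Obj suc (σ-obj i)

  mutual
    sub-Obj : (∀ i → Obj Th (σ i)) → Obj Th M → Obj Th (sub σ M)
    sub-Obj σ-obj (ovar {i})   = σ-obj i
    sub-Obj σ-obj (ocon t os)  = ocon t (sub-Objs σ-obj os)
    sub-Obj σ-obj (oapp o o′)  = oapp (sub-Obj σ-obj o) (sub-Obj σ-obj o′)
    sub-Obj σ-obj (olam f o)   = olam (sub-Fam σ-obj f) (sub-Obj (exts-Obj σ-obj) o)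

    sub-Fam : (∀ i → Obj Th (σ i)) → Fam Th A → Fam Th (sub σ A)
    sub-Fam σ-obj (fcon t os)  = fcon t (sub-Objs σ-obj os)
    sub-Fam σ-obj (fapp f o)   = fapp (sub-Fam σ-obj f) (sub-Obj σ-obj o)
    sub-Fam σ-obj (flam f f′)  = flam (sub-Fam σ-obj f) (sub-Fam (exts-Obj σ-obj) f′)
    sub-Fam σ-obj (fpi f f′)   = fpi (sub-Fam σ-obj f) (sub-Fam (exts-Obj σ-obj) f′)

    sub-Objs : (∀ i → Obj Th (σ i)) → Objs Th xs → Objs Th (subs σ xs)
    sub-Objs σ-obj []        = []
    sub-Objs σ-obj (o ∷ os)  = sub-Obj σ-obj o ∷ sub-Objs σ-obj os

  Obj-⟪⟫ : Obj Th M → ⟪ M ⟫ ≡ nothing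
  Obj-⟪⟫ ovar                       = refl
  Obj-⟪⟫ (ocon {c} t os) with typeLevel Th c
  ... | false                       = refl
  Obj-⟪⟫ (oapp o o′)                = Obj-⟪⟫ o
  Obj-⟪⟫ (olam f o)                 = Obj-⟪⟫ o

  Fam-⟪⟫ : Fam Th A → ∃ λ s → ⟪ A ⟫ ≡ just s
  Fam-⟪⟫ (fcon {c} t os) with typeLevel Th c
  ... | true                        = ⋆ , refl
  Fam-⟪⟫ (fapp f o)                 = Fam-⟪⟫ f
  Fam-⟪⟫ (flam f f′)                = Fam-⟪⟫ f′
  Fam-⟪⟫ (fpi f f′) with Fam-⟪⟫ f | Fam-⟪⟫ f′
  ... | s , e | s′ , e′ rewrite e | e′ = s ⇒ s′ , refl

  ⟪⟫-rename : ∀ ρ M → ⟪ rename ρ M ⟫ ≡ ⟪ M ⟫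
  ⟪⟫-rename ρ (var i)    = refl
  ⟪⟫-rename ρ (con c xs) = refl
  ⟪⟫-rename ρ TYPE       = refl
  ⟪⟫-rename ρ KIND       = refl
  ⟪⟫-rename ρ (app A N)  = ⟪⟫-rename ρ A
  ⟪⟫-rename ρ (lam A B)  = ⟪⟫-rename (ext ρ) B
  ⟪⟫-rename ρ (pi A B) rewrite ⟪⟫-rename ρ A | ⟪⟫-rename (ext ρ) B = refl

  ⟪⟫-sub : (∀ i → Obj Th (σ i)) → ∀ M → ⟪ sub σ M ⟫ ≡ ⟪ M ⟫
  ⟪⟫-sub σ-obj (var i)    = Obj-⟪⟫ (σ-obj i)
  ⟪⟫-sub σ-obj (con c xs) = refl
  ⟪⟫-sub σ-obj TYPE       = refl
  ⟪⟫-sub σ-obj KIND       = refl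
  ⟪⟫-sub σ-obj (app A N)  = ⟪⟫-sub σ-obj A
  ⟪⟫-sub σ-obj (lam A B)  = ⟪⟫-sub (exts-Obj σ-obj) B
  ⟪⟫-sub σ-obj (pi A B) rewrite ⟪⟫-sub σ-obj A | ⟪⟫-sub (exts-Obj σ-obj) B = refl

  mutual
    ⟦⟧-rename : ∀ ρ M → ⟦ rename ρ M ⟧ ≡ map (urename ρ) ⟦ M ⟧
    ⟦⟧-rename ρ (var i) = refl
    ⟦⟧-rename ρ (con c xs) rewrite ⟦⟧*-rename ρ xs with ⟦ xs ⟧*
    ... | just us = cong just (sym (urename-appsU ρ (con c) us))
    ... | nothing = refl
    ⟦⟧-rename ρ TYPE = refl
    ⟦⟧-rename ρ KIND = refl
    ⟦⟧-rename ρ (app M N) rewrite ⟦⟧-rename ρ M | ⟦⟧-rename ρ N with ⟦ M ⟧ | ⟦ N ⟧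
    ... | just m  | just n  = refl
    ... | just m  | nothing = refl
    ... | nothing | _       = refl
    ⟦⟧-rename ρ (lam A M) rewrite ⟦⟧-rename ρ A | ⟦⟧-rename (ext ρ) M with ⟦ A ⟧ | ⟦ M ⟧
    ... | just a  | just m  = cong just (sym (urename-uλ ρ a m))
    ... | just a  | nothing = refl
    ... | nothing | _       = refl
    ⟦⟧-rename ρ (pi A B)
      rewrite ⟪⟫-rename ρ A | ⟦⟧-rename ρ A | ⟦⟧-rename (ext ρ) B with ⟪ A ⟫ | ⟦ A ⟧ | ⟦ B ⟧
    ... | just s  | just a  | just b  = refl
    ... | just s  | just a  | nothing = refl
    ... | just s  | nothing | _       = refl
    ... | nothing | _       | _       = refl

    ⟦⟧*-rename : ∀ ρ (xs : Vec (Term K) k) → ⟦ renames ρ xs ⟧* ≡ map (Vec.map (urename ρ)) ⟦ xs ⟧*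
    ⟦⟧*-rename ρ [] = refl
    ⟦⟧*-rename ρ (M ∷ xs) rewrite ⟦⟧-rename ρ M | ⟦⟧*-rename ρ xs with ⟦ M ⟧ | ⟦ xs ⟧*
    ... | just u  | just us = refl
    ... | just u  | nothing = refl
    ... | nothing | _       = refl

  ObjSubst : (ℕ → Term K) → (ℕ → UTerm K) → Set
  ObjSubst σ τ = ∀ i → Obj Th (σ i) × ⟦ σ i ⟧ ≡ just (τ i)

  exts-ObjSubst : ObjSubst σ τ → ObjSubst (exts σ) (uexts τ)
  exts-ObjSubst ok zero    = ovar , refl
  exts-ObjSubst {σ} ok (suc i) with ok i
  ... | o , e = rename-Obj suc o , trans (⟦⟧-rename suc (σ i)) (cong (map (urename suc)) e)

  mutual
    ⟦⟧-sub : ObjSubst σ τ → ∀ M → ⟦ sub σ M ⟧ ≡ map (usub τ) ⟦ M ⟧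
    ⟦⟧-sub ok (var i) = proj₂ (ok i)
    ⟦⟧-sub {τ = τ} ok (con c xs) rewrite ⟦⟧*-sub ok xs with ⟦ xs ⟧*
    ... | just us = cong just (sym (usub-appsU τ (con c) us))
    ... | nothing = refl
    ⟦⟧-sub ok TYPE = refl
    ⟦⟧-sub ok KIND = refl
    ⟦⟧-sub ok (app M N) rewrite ⟦⟧-sub ok M | ⟦⟧-sub ok N with ⟦ M ⟧ | ⟦ N ⟧
    ... | just m  | just n  = refl
    ... | just m  | nothing = refl
    ... | nothing | _       = refl
    ⟦⟧-sub {τ = τ} ok (lam A M)
      rewrite ⟦⟧-sub ok A | ⟦⟧-sub (exts-ObjSubst ok) M with ⟦ A ⟧ | ⟦ M ⟧
    ... | just a  | just m  = cong just (sym (usub-uλ τ a m))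
    ... | just a  | nothing = refl
    ... | nothing | _       = refl
    ⟦⟧-sub ok (pi A B)
      rewrite ⟪⟫-sub (proj₁ ∘ ok) A | ⟦⟧-sub ok A | ⟦⟧-sub (exts-ObjSubst ok) B
      with ⟪ A ⟫ | ⟦ A ⟧ | ⟦ B ⟧
    ... | just s  | just a  | just b  = refl
    ... | just s  | just a  | nothing = refl
    ... | just s  | nothing | _       = refl
    ... | nothing | _       | _       = refl

    ⟦⟧*-sub : ObjSubst σ τ → (xs : Vec (Term K) k) → ⟦ subs σ xs ⟧* ≡ map (Vec.map (usub τ)) ⟦ xs ⟧*
    ⟦⟧*-sub ok [] = refl
    ⟦⟧*-sub ok (M ∷ xs) rewrite ⟦⟧-sub ok M | ⟦⟧*-sub ok xs with ⟦ M ⟧ | ⟦ xs ⟧*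
    ... | just u  | just us = refl
    ... | just u  | nothing = refl
    ... | nothing | _       = refl

  σAt-ObjSubst : ∀ x → Obj Th N → ⟦ N ⟧ ≡ just n → ObjSubst (σAt x N) (uσAt x n)
  σAt-ObjSubst x oN eN i with i <ᵇ x
  ... | true  = ovar , refl
  ... | false with i ≡ᵇ x
  ... | true  = oN , eN
  ... | false = ovar , refl

  record Translatable (M : Term K) : Set where
    constructor translation
    field
      {image} : UTerm K
      ⟦⟧≡     : ⟦ M ⟧ ≡ just image

  record Translatable* (xs : Vec (Term K) k) : Set where
    constructor translation*
    field
      {images} : Vec (UTerm K) k
      ⟦⟧*≡     : ⟦ xs ⟧* ≡ just images

  mutual
    Obj-translatable : Obj Th M → Translatable M
    Obj-translatable ovar = translation refl
    Obj-translatable (ocon {c} {xs} t os) with Objs-translatable os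
    ... | translation* e = translation (⟦con⟧ c xs e)
    Obj-translatable (oapp {M} {N} o o′) with Obj-translatable o | Obj-translatable o′
    ... | translation e | translation e′ = translation (⟦app⟧ M N e e′)
    Obj-translatable (olam {A} {M} f o) with Fam-translatable f | Obj-translatable o
    ... | translation e | translation e′ = translation (⟦lam⟧ A M e e′)

    Fam-translatable : Fam Th A → Translatable A
    Fam-translatable (fcon {c} {xs} t os) with Objs-translatable os
    ... | translation* e = translation (⟦con⟧ c xs e)
    Fam-translatable (fapp {A} {N} f o) with Fam-translatable f | Obj-translatable o
    ... | translation e | translation e′ = translation (⟦app⟧ A N e e′)
    Fam-translatable (flam {A} {B} f f′) with Fam-translatable f | Fam-translatable f′
    ... | translation e | translation e′ = translation (⟦lam⟧ A B e e′)
    Fam-translatable (fpi {A} {B} f f′) with Fam-⟪⟫ f | Fam-translatable f | Fam-translatable f′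
    ... | s , eₛ | translation e | translation e′ = translation (⟦pi⟧ A B eₛ e e′)

    Objs-translatable : Objs Th xs → Translatable* xs
    Objs-translatable [] = translation* refl
    Objs-translatable (_∷_ {M = M} {Ms = xs} o os) with Obj-translatable o | Objs-translatable os
    ... | translation e | translation* e′ = translation* (⟦∷⟧ M xs e e′)

  ObjOrFam-translatable : ObjOrFam Th M → Translatable M
  ObjOrFam-translatable (inj₁ o) = Obj-translatable o
  ObjOrFam-translatable (inj₂ f) = Fam-translatable f

  σAt-Obj : ∀ x → Obj Th N → ∀ i → Obj Th (σAt x N i)
  σAt-Obj x oN with Obj-translatable oN
  ... | translation eN = proj₁ ∘ σAt-ObjSubst x oN eN

  ⟦⟧-[≔] : ∀ x → Obj Th N → ⟦ N ⟧ ≡ just n → ⟦ M ⟧ ≡ just m →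
           ⟦ M [ x ≔ N ] ⟧ ≡ just (m [ x ≔ n ]ᵘ)
  ⟦⟧-[≔] {M = M} x oN eN eM =
    trans (⟦⟧-sub (σAt-ObjSubst x oN eN) M) (cong (map (usub (uσAt x _))) eM)

  ObjOrFam-[≔] : ∀ x → Obj Th N → ObjOrFam Th M → ObjOrFam Th (M [ x ≔ N ])
  ObjOrFam-[≔] x oN (inj₁ o) = inj₁ (sub-Obj (σAt-Obj x oN) o)
  ObjOrFam-[≔] x oN (inj₂ f) = inj₂ (sub-Fam (σAt-Obj x oN) f)

  ⟪⟫-↪β : Fam Th A → A ↪β A′ → ⟪ A′ ⟫ ≡ ⟪ A ⟫
  ⟪⟫-↪β (fapp (flam {B = B} f f′) o) (head β) = ⟪⟫-sub (σAt-Obj 0 o) B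
  ⟪⟫-↪β (fapp f o)  (appl r) = ⟪⟫-↪β f r
  ⟪⟫-↪β (fapp f o)  (appr r) = refl
  ⟪⟫-↪β (flam f f′) (laml r) = refl
  ⟪⟫-↪β (flam f f′) (lamr r) = ⟪⟫-↪β f′ r
  ⟪⟫-↪β (fpi f f′)  (pil r) rewrite ⟪⟫-↪β f r = refl
  ⟪⟫-↪β (fpi f f′)  (pir r) rewrite ⟪⟫-↪β f′ r = refl
  ⟪⟫-↪β (fcon t os) (arg i r) = refl


  record _∣↪⁺∣_ (M M′ : Term K) : Set where
    constructor simulation
    field
      {source target} : UTerm K
      ⟦source⟧≡       : ⟦ M ⟧ ≡ just source
      ⟦target⟧≡       : ⟦ M′ ⟧ ≡ just target
      steps           : source ↪βᵘ⁺ target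

  -- A step inside an argument vector is simulated in every spine h u₁ ⋯ uₖ.
  record _∣↪⁺∣*_ (xs xs′ : Vec (Term K) k) : Set where
    constructor simulation*
    field
      {sources targets} : Vec (UTerm K) k
      ⟦sources⟧≡        : ⟦ xs ⟧* ≡ just sources
      ⟦targets⟧≡        : ⟦ xs′ ⟧* ≡ just targets
      steps             : ∀ h → appsU h sources ↪βᵘ⁺ appsU h targets

  ∣↪⁺∣-β : Translatable A → Translatable M → Obj Th N → app (lam A M) N ∣↪⁺∣ (M [ 0 ≔ N ])
  ∣↪⁺∣-β {A} {M} {N} (translation eA) (translation eM) oN with Obj-translatable oN
  ... | translation eN =
    simulation (⟦app⟧ (lam A M) N (⟦lam⟧ A M eA eM) eN) (⟦⟧-[≔] {M = M} 0 oN eN eM) uλ-β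

  ∣↪⁺∣-appˡ : M ∣↪⁺∣ M′ → Translatable N → app M N ∣↪⁺∣ app M′ N
  ∣↪⁺∣-appˡ {M} {M′} {N} (simulation e e′ r) (translation eN) =
    simulation (⟦app⟧ M N e eN) (⟦app⟧ M′ N e′ eN) (TransClosure-map appl r)

  ∣↪⁺∣-appʳ : Translatable M → N ∣↪⁺∣ N′ → app M N ∣↪⁺∣ app M N′
  ∣↪⁺∣-appʳ {M} {N} {N′} (translation eM) (simulation e e′ r) =
    simulation (⟦app⟧ M N eM e) (⟦app⟧ M N′ eM e′) (TransClosure-map appr r)

  ∣↪⁺∣-lamˡ : A ∣↪⁺∣ A′ → Translatable M → lam A M ∣↪⁺∣ lam A′ M
  ∣↪⁺∣-lamˡ {A} {A′} {M} (simulation e e′ r) (translation eM) =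
    simulation (⟦lam⟧ A M e eM) (⟦lam⟧ A′ M e′ eM) (TransClosure-map appr r)

  ∣↪⁺∣-lamʳ : Translatable A → M ∣↪⁺∣ M′ → lam A M ∣↪⁺∣ lam A M′
  ∣↪⁺∣-lamʳ {A} {M} {M′} (translation eA) (simulation e e′ r) =
    simulation (⟦lam⟧ A M eA e) (⟦lam⟧ A M′ eA e′) (TransClosure-map uλ-↪βᵘ r)

  ∣↪⁺∣-piˡ : ⟪ A ⟫ ≡ just s → ⟪ A′ ⟫ ≡ just s → A ∣↪⁺∣ A′ → Translatable B → pi A B ∣↪⁺∣ pi A′ B
  ∣↪⁺∣-piˡ {A} {s} {A′} {B} eₛ eₛ′ (simulation e e′ r) (translation eB) =
    simulation (⟦pi⟧ A B eₛ e eB) (⟦pi⟧ A′ B eₛ′ e′ eB) (TransClosure-map (λ r → appl (appr r)) r)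

  ∣↪⁺∣-piʳ : ⟪ A ⟫ ≡ just s → Translatable A → B ∣↪⁺∣ B′ → pi A B ∣↪⁺∣ pi A B′
  ∣↪⁺∣-piʳ {A} {s} {B} {B′} eₛ (translation eA) (simulation e e′ r) =
    simulation (⟦pi⟧ A B eₛ eA e) (⟦pi⟧ A B′ eₛ eA e′) (TransClosure-map (λ r → appr (lamc r)) r)

  ∣↪⁺∣-con : ∀ c {xs xs′ : Vec (Term K) (arity K c)} → xs ∣↪⁺∣* xs′ → con c xs ∣↪⁺∣ con c xs′
  ∣↪⁺∣-con c {xs} {xs′} (simulation* e e′ r) =
    simulation (⟦con⟧ c xs e) (⟦con⟧ c xs′ e′) (r (con c))

  ∣↪⁺∣*-here : M ∣↪⁺∣ M′ → Translatable* xs → (M ∷ xs) ∣↪⁺∣* (M′ ∷ xs)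
  ∣↪⁺∣*-here {M} {M′} {xs = xs} (simulation e e′ r) (translation* {us} exs) =
    simulation* (⟦∷⟧ M xs e exs) (⟦∷⟧ M′ xs e′ exs)
                (λ h → appsU-↪βᵘ⁺ us (TransClosure-map {f = app h} appr r))

  ∣↪⁺∣*-there : Translatable M → xs ∣↪⁺∣* xs′ → (M ∷ xs) ∣↪⁺∣* (M ∷ xs′)
  ∣↪⁺∣*-there {M} {xs = xs} {xs′ = xs′} (translation {u} eM) (simulation* e e′ r) =
    simulation* (⟦∷⟧ M xs eM e) (⟦∷⟧ M xs′ eM e′) (λ h → r (app h u))

  mutual
    Obj-↪β : Obj Th M → M ↪β M′ → Obj Th M′ × M ∣↪⁺∣ M′
    Obj-↪β (oapp (olam f o) oN) (head β) =
      sub-Obj (σAt-Obj 0 oN) o , ∣↪⁺∣-β (Fam-translatable f) (Obj-translatable o) oN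
    Obj-↪β (oapp o oN) (appl r) =
      let o′ , sim = Obj-↪β o r in oapp o′ oN , ∣↪⁺∣-appˡ sim (Obj-translatable oN)
    Obj-↪β (oapp o oN) (appr r) =
      let oN′ , sim = Obj-↪β oN r in oapp o oN′ , ∣↪⁺∣-appʳ (Obj-translatable o) sim
    Obj-↪β (olam f o) (laml r) =
      let f′ , sim = Fam-↪β f r in olam f′ o , ∣↪⁺∣-lamˡ sim (Obj-translatable o)
    Obj-↪β (olam f o) (lamr r) =
      let o′ , sim = Obj-↪β o r in olam f o′ , ∣↪⁺∣-lamʳ (Fam-translatable f) sim
    Obj-↪β (ocon {c} t os) (arg i r) =
      let os′ , sim = Objs-↪β os i r in ocon t os′ , ∣↪⁺∣-con c sim

    Fam-↪β : Fam Th A → A ↪β A′ → Fam Th A′ × A ∣↪⁺∣ A′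
    Fam-↪β (fapp (flam f f′) oN) (head β) =
      sub-Fam (σAt-Obj 0 oN) f′ , ∣↪⁺∣-β (Fam-translatable f) (Fam-translatable f′) oN
    Fam-↪β (fapp f oN) (appl r) =
      let f′ , sim = Fam-↪β f r in fapp f′ oN , ∣↪⁺∣-appˡ sim (Obj-translatable oN)
    Fam-↪β (fapp f oN) (appr r) =
      let oN′ , sim = Obj-↪β oN r in fapp f oN′ , ∣↪⁺∣-appʳ (Fam-translatable f) sim
    Fam-↪β (flam f f′) (laml r) =
      let g , sim = Fam-↪β f r in flam g f′ , ∣↪⁺∣-lamˡ sim (Fam-translatable f′)
    Fam-↪β (flam f f′) (lamr r) =
      let g′ , sim = Fam-↪β f′ r in flam f g′ , ∣↪⁺∣-lamʳ (Fam-translatable f) sim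
    Fam-↪β (fpi f f′) (pil r) =
      let g , sim = Fam-↪β f r
          s , eₛ  = Fam-⟪⟫ f
      in fpi g f′ , ∣↪⁺∣-piˡ eₛ (trans (⟪⟫-↪β f r) eₛ) sim (Fam-translatable f′)
    Fam-↪β (fpi f f′) (pir r) =
      let g′ , sim = Fam-↪β f′ r
          s , eₛ   = Fam-⟪⟫ f
      in fpi f g′ , ∣↪⁺∣-piʳ eₛ (Fam-translatable f) sim
    Fam-↪β (fcon {c} t os) (arg i r) =
      let os′ , sim = Objs-↪β os i r in fcon t os′ , ∣↪⁺∣-con c sim

    Objs-↪β : Objs Th xs → (i : Fin k) → lookup xs i ↪β N →
              Objs Th (xs [ i ]≔ N) × xs ∣↪⁺∣* (xs [ i ]≔ N)
    Objs-↪β (o ∷ os) fzero r =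
      let o′ , sim = Obj-↪β o r in o′ ∷ os , ∣↪⁺∣*-here sim (Objs-translatable os)
    Objs-↪β (o ∷ os) (fsuc i) r =
      let os′ , sim = Objs-↪β os i r in o ∷ os′ , ∣↪⁺∣*-there (Obj-translatable o) sim

  ObjOrFam-↪β : ObjOrFam Th M → M ↪β M′ → ObjOrFam Th M′ × M ∣↪⁺∣ M′
  ObjOrFam-↪β (inj₁ o) r = let o′ , sim = Obj-↪β o r in inj₁ o′ , sim
  ObjOrFam-↪β (inj₂ f) r = let f′ , sim = Fam-↪β f r in inj₂ f′ , sim

mainTheorem7 : ∀ {K : Consts} (Th : Theory K) →
    Confluent Th → ArityPreserving Th →
    ∀ (M : Term K) → ObjOrFam Th M →
      ((N : Term K) (x : ℕ) → Obj Th N →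
        ObjOrFam Th (M [ x ≔ N ]) ×
        ∃ λ m → ∃ λ n →
          ∣_∣ Th M ≡ just m × ∣_∣ Th N ≡ just n ×
          ∣_∣ Th (M [ x ≔ N ]) ≡ just (m [ x ≔ n ]ᵘ))
      ×
      ((N : Term K) → M ↪β N →
        ObjOrFam Th N ×
        ∃ λ m → ∃ λ n →
          ∣_∣ Th M ≡ just m × ∣_∣ Th N ≡ just n × m ↪βᵘ⁺ n)
mainTheorem7 Th _ _ M oM =
  (λ N x oN →
    let translation eM = ObjOrFam-translatable Th oM
        translation eN = Obj-translatable Th oN
    in ObjOrFam-[≔] Th x oN oM , _ , _ , eM , eN , ⟦⟧-[≔] Th {M = M} x oN eN eM) ,
  (λ N r →
    let oN , simulation eM eN steps = ObjOrFam-↪β Th oM r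
    in oN , _ , _ , eM , eN , steps)
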